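{- Let $w$ be a finite rich word with $|\mathrm{Alph}(w)|\ge 2$. Then there exists a finite word $u$ with $|u|<2|w|$ such that $wu$ is rich and there are at least two distinct letters $a\in\mathrm{Alph}(wu)$ for which $wua$ is rich.
   Context: A palindrome is a word equal to its reversal; the empty word is a palindrome. Every finite word $w$ has at most $|w|+1$ distinct palindromic factors (counting the empty word); $w$ is called rich if it has exactly $|w|+1$ distinct palindromic factors. $\mathrm{Alph}(w)$ is the set of letters occurring in $w$. -}

module Defs where

open import Data.List using (List; []; _∷_; _++_; reverse; length; [_])
open import Data.List.Membership.Propositional using (_∈_)
open import Data.List.Relation.Unary.Unique.Propositional using (Unique)
open import Data.List.Relation.Unary.All using (All)
open import Data.Nat using (ℕ; suc)
open import Data.Product using (Σ; ∃; _×_; _,_)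
open import Relation.Binary.PropositionalEquality using (_≡_)

IsPalindrome : ∀ {A : Set} → List A → Set
IsPalindrome w = reverse w ≡ w

IsFactor : ∀ {A : Set} → List A → List A → Set
IsFactor f w = ∃ λ x → ∃ λ y → x ++ f ++ y ≡ w

PalFactor : ∀ {A : Set} → List A → List A → Set
PalFactor w f = IsPalindrome f × IsFactor f w

-- ps is an exhaustive, duplicate-free enumeration of the distinct
-- palindromic factors of w (the empty word included).
PalFactorList : ∀ {A : Set} → List A → List (List A) → Set
PalFactorList w ps =
  Unique ps × All (PalFactor w) ps × (∀ f → PalFactor w f → f ∈ ps)

NumPalFactors : ∀ {A : Set} → List A → ℕ → Set
NumPalFactors w n = ∃ λ ps → PalFactorList w ps × length ps ≡ n

Rich : ∀ {A : Set} → List A → Set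
Rich w = NumPalFactors w (suc (length w))

-- The longest palindromic suffix p of the rich word w = s p occurs only once in w, so appending
-- reverse s letter by letter keeps the word rich and ends in the rich palindrome P = w (reverse s).
-- Likewise, if q is the longest proper palindromic suffix of P = z y q, then y q y does not occur
-- in P, and appending y (reverse z) keeps P rich; the result has period |z y| ≤ |P| < 2|w|.
-- Let c^R be the longest run of a letter c of w in this periodic word. Shifting by the period, some
-- occurrence ends within one period after w (it cannot cover w, which has a second letter), so a
-- rich prefix W = w u′ ends with g c^R, g ≠ c. As c^(R+1) does not occur in W, the palindromes
-- c^(R+1), c^(R+2) and g c^(R+1) g are new in W c, W c c and W c g, which are therefore rich.

module Submission where

open import Defs
open import Data.Empty using (⊥-elim)
open import Data.List using (List; []; _∷_; _++_; _∷ʳ_; [_]; length; reverse; replicate; filter)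
open import Data.List.Properties
  using (++-monoid; ++-assoc; ++-identityʳ; ++-conicalˡ; ++-conicalʳ; ∷-injective; ∷-injectiveʳ; ∷ʳ-injectiveˡ;
         ≡-dec; length-++; length-++-≤ˡ; length-++-≤ʳ; length-replicate; length-reverse;
         reverse-++; unfold-reverse; reverse-involutive; filter-accept; filter-reject; filter-all)
open import Data.List.Membership.Propositional using (_∈_)
open import Data.List.Membership.Propositional.Properties using (∉[]; ∈-++⁺ˡ; ∈-++⁺ʳ; ∈-filter⁺)
open import Data.List.Relation.Unary.All as All using (All; []; _∷_; all?)
import Data.List.Relation.Unary.All.Properties as All
open import Data.List.Relation.Unary.Any using (here; there)
open import Data.List.Relation.Unary.AllPairs using ([]; _∷_)
open import Data.List.Relation.Unary.Unique.Propositional using (Unique)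
import Data.List.Relation.Unary.Unique.Propositional.Properties as Unique
open import Data.List.Reverse using (Reverse; reverseView; []; _∶_∶ʳ_)
open import Data.Nat using (ℕ; zero; suc; _+_; _*_; _≤_; _<_; z≤n; s≤s)
open import Data.Nat.Properties
  using (≤-refl; ≤-trans; ≤-reflexive; ≤-antisym; ≤-pred; <-irrefl; <⇒≱; ≮⇒≥; 1+n≰n; n≤1+n; m≤n⇒m≤1+n;
         m≤m+n; m≤n+m; m<m+n; +-comm; +-assoc; +-suc; +-identityʳ; +-monoʳ-≤; +-monoˡ-≤; +-cancelˡ-≤; +-cancelˡ-<;
         _≤?_; _<?_; module ≤-Reasoning)
open import Data.Product using (∃; ∃₂; _×_; _,_; proj₁; proj₂)
open import Data.Sum using (_⊎_; inj₁; inj₂)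
open import Function using (_∘_)
open import Relation.Binary.Definitions using (DecidableEquality)
open import Relation.Binary.PropositionalEquality
  using (_≡_; _≢_; refl; sym; trans; cong; cong₂; subst; subst₂; module ≡-Reasoning)
open import Relation.Nullary using (¬_; Dec; yes; no)
open import Relation.Unary using (Decidable)

private variable
  A : Set

∷ʳ-view : (xs : List A) → xs ≡ [] ⊎ ∃₂ λ ys y → xs ≡ ys ∷ʳ y
∷ʳ-view xs with reverseView xs
... | [] = inj₁ refl
... | ys ∶ _ ∶ʳ y = inj₂ (ys , y , refl)

++-≡-++-cases : (v v′ x x′ : List A) → v ++ v′ ≡ x ++ x′ →
  (∃ λ m → v ≡ x ++ m × m ++ v′ ≡ x′) ⊎ (∃ λ m → x ≡ v ++ m × v′ ≡ m ++ x′)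
++-≡-++-cases []      v′ x       x′ e = inj₂ (x , refl , e)
++-≡-++-cases (a ∷ v) v′ []      x′ e = inj₁ (a ∷ v , refl , e)
++-≡-++-cases (a ∷ v) v′ (b ∷ x) x′ e with ∷-injective e
... | refl , e′ with ++-≡-++-cases v v′ x x′ e′
...   | inj₁ (m , v≡ , m++v′≡) = inj₁ (m , cong (a ∷_) v≡ , m++v′≡)
...   | inj₂ (m , x≡ , v′≡)   = inj₂ (m , cong (a ∷_) x≡ , v′≡)

suffixes-comparable : (k f l g : List A) → k ++ f ≡ l ++ g →
  (∃ λ h → f ≡ h ++ g) ⊎ (∃ λ h → g ≡ h ++ f)
suffixes-comparable k f l g e with ++-≡-++-cases k f l g e
... | inj₁ (m , _ , m++f≡g) = inj₂ (m , sym m++f≡g)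
... | inj₂ (m , _ , f≡m++g) = inj₁ (m , f≡m++g)

++-≢-[] : (xs : List A) (y : A) (ys : List A) → xs ++ y ∷ ys ≢ []
++-≢-[] []      _ _ ()
++-≢-[] (_ ∷ _) _ _ ()

reverse-≢-[] : {xs : List A} → xs ≢ [] → reverse xs ≢ []
reverse-≢-[] {xs = xs} xs≢[] e = xs≢[] (trans (sym (reverse-involutive xs)) (cong reverse e))

≢[]⇒length-pos : ∀ {xs : List A} → xs ≢ [] → 1 ≤ length xs
≢[]⇒length-pos {xs = []}    xs≢[] = ⊥-elim (xs≢[] refl)
≢[]⇒length-pos {xs = _ ∷ _} _     = s≤s z≤n

length-∷ʳ : (w : List A) (a : A) → length (w ∷ʳ a) ≡ suc (length w)
length-∷ʳ []      a = refl
length-∷ʳ (_ ∷ w) a = cong suc (length-∷ʳ w a)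

length-++-replicate : ∀ (w : List A) n c → length (w ++ replicate n c) ≡ length w + n
length-++-replicate w n c = trans (length-++ w) (cong (length w +_) (length-replicate n))

length-<-infix : (h f t : List A) → t ≢ [] → length f < length (h ++ f ++ t)
length-<-infix (_ ∷ h) f       t       t≢[] = m≤n⇒m≤1+n (length-<-infix h f t t≢[])
length-<-infix []      (_ ∷ f) t       t≢[] = s≤s (length-<-infix [] f t t≢[])
length-<-infix []      []      []      t≢[] = ⊥-elim (t≢[] refl)
length-<-infix []      []      (_ ∷ _) _    = s≤s z≤n

proper-suffix-shorter : ∀ {k q : List A} {x w} → k ≢ [] → k ++ q ≡ x ∷ w → length q ≤ length w
proper-suffix-shorter {k = []}    k≢[] _ = ⊥-elim (k≢[] refl)
proper-suffix-shorter {k = _ ∷ k} _    e = subst (λ v → _ ≤ length v) (∷-injectiveʳ e) (length-++-≤ʳ _ {k})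

prefix-split : ∀ (x y w v : List A) → x ++ y ≡ w ++ v → length w ≤ length x → ∃ λ u → x ≡ w ++ u × u ++ y ≡ v
prefix-split x y w v e w≤x with ++-≡-++-cases x y w v e
... | inj₁ (u , x≡w++u , u++y≡v) = u , x≡w++u , u++y≡v
... | inj₂ ([] , w≡x++[] , y≡v) = [] , sym (trans (++-identityʳ w) (trans w≡x++[] (++-identityʳ x))) , y≡v
... | inj₂ (b ∷ m , w≡x++bm , _) =
  ⊥-elim (<⇒≱ (subst (λ t → length x < length t) (sym w≡x++bm) (length-<-infix [] x (b ∷ m) (λ ()))) w≤x)

<-double : ∀ {k n m} → k ≤ n + m → m < n → k < 2 * n
<-double {k} {n} {m} k≤n+m m<n = begin-strict
  k            <⟨ s≤s k≤n+m ⟩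
  suc (n + m)  ≡⟨ sym (+-suc n m) ⟩
  n + suc m    ≤⟨ +-monoʳ-≤ n m<n ⟩
  n + n        ≡⟨ cong (n +_) (sym (+-identityʳ n)) ⟩
  2 * n        ∎
  where open ≤-Reasoning

factor-length-≤ : ∀ {f w : List A} → IsFactor f w → length f ≤ length w
factor-length-≤ {f = f} (x , y , refl) = ≤-trans (length-++-≤ˡ f) (length-++-≤ʳ (f ++ y) {x})

suffix⇒factor : ∀ {k f w : List A} → k ++ f ≡ w → IsFactor f w
suffix⇒factor {k = k} {f} refl = k , [] , cong (k ++_) (++-identityʳ f)

factor-++ʳ : ∀ {f w : List A} v → IsFactor f w → IsFactor f (w ++ v)
factor-++ʳ {f = f} v (x , y , refl) =
  x , y ++ v , trans (cong (x ++_) (sym (++-assoc f y v))) (sym (++-assoc x (f ++ y) v))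

factor-of-init : ∀ (w : List A) a k f t → k ++ f ++ t ≡ w ∷ʳ a → t ≢ [] → IsFactor f w
factor-of-init w a k f t e t≢[] with ∷ʳ-view t
... | inj₁ t≡[] = ⊥-elim (t≢[] t≡[])
... | inj₂ (t′ , b , refl) = k , t′ , ∷ʳ-injectiveˡ (k ++ f ++ t′) w
        (trans (++-assoc k (f ++ t′) [ b ]) (trans (cong (k ++_) (++-assoc f t′ [ b ])) e))

new-factor-is-suffix : ∀ (w : List A) a f → IsFactor f (w ∷ʳ a) → ¬ IsFactor f w →
  ∃ λ k → k ++ f ≡ w ∷ʳ a
new-factor-is-suffix w a f (k , [] , e) _ = k , trans (cong (k ++_) (sym (++-identityʳ f))) e
new-factor-is-suffix w a f (k , b ∷ t , e) f∉w = ⊥-elim (f∉w (factor-of-init w a k f (b ∷ t) e λ ()))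

replicate-∷ʳ : ∀ n (c : A) → replicate n c ∷ʳ c ≡ c ∷ replicate n c
replicate-∷ʳ zero    c = refl
replicate-∷ʳ (suc n) c = cong (c ∷_) (replicate-∷ʳ n c)

run-prefix-all : ∀ R (c : A) {m x y b} → replicate R c ++ b ≡ m ++ x ++ y → length m + length x ≤ R → All (_≡ c) x
run-prefix-all (suc R) c {_ ∷ m} e (s≤s h) = run-prefix-all R c {m} (∷-injectiveʳ e) h
run-prefix-all R       c {[]} {[]}    _ _       = []
run-prefix-all (suc R) c {[]} {_ ∷ x} e (s≤s h) = sym (proj₁ (∷-injective e)) ∷ run-prefix-all R c {[]} {x} (∷-injectiveʳ e) h

palindrome-wrap : ∀ (a : A) {p} → IsPalindrome p → IsPalindrome (a ∷ p ++ [ a ])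
palindrome-wrap a {p} pal = begin
  reverse (a ∷ p ++ [ a ])       ≡⟨ unfold-reverse a (p ++ [ a ]) ⟩
  reverse (p ++ [ a ]) ++ [ a ]  ≡⟨ cong (_++ [ a ]) (reverse-++ p [ a ]) ⟩
  a ∷ reverse p ++ [ a ]         ≡⟨ cong (λ q → a ∷ q ++ [ a ]) pal ⟩
  a ∷ p ++ [ a ]                 ∎
  where open ≡-Reasoning

palindrome-replicate : ∀ n (c : A) → IsPalindrome (replicate n c)
palindrome-replicate zero    c = refl
palindrome-replicate (suc n) c = begin
  reverse (c ∷ replicate n c)       ≡⟨ unfold-reverse c (replicate n c) ⟩
  reverse (replicate n c) ∷ʳ c      ≡⟨ cong (_∷ʳ c) (palindrome-replicate n c) ⟩
  replicate n c ∷ʳ c                ≡⟨ replicate-∷ʳ n c ⟩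
  c ∷ replicate n c                 ∎
  where open ≡-Reasoning

palindrome-closure : ∀ (s : List A) {p} → IsPalindrome p → IsPalindrome (s ++ p ++ reverse s)
palindrome-closure s {p} pal = begin
  reverse (s ++ p ++ reverse s)                    ≡⟨ reverse-++ s (p ++ reverse s) ⟩
  reverse (p ++ reverse s) ++ reverse s            ≡⟨ cong (_++ reverse s) (reverse-++ p (reverse s)) ⟩
  (reverse (reverse s) ++ reverse p) ++ reverse s  ≡⟨ cong₂ (λ u v → (u ++ v) ++ reverse s) (reverse-involutive s) pal ⟩
  (s ++ p) ++ reverse s                            ≡⟨ ++-assoc s p (reverse s) ⟩
  s ++ p ++ reverse s                              ∎
  where open ≡-Reasoning

palindromic-suffix-is-prefix : ∀ {p q h : List A} → IsPalindrome p → IsPalindrome q →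
  p ≡ h ++ q → p ≡ q ++ reverse h
palindromic-suffix-is-prefix {p = p} {q} {h} pal-p pal-q p≡h++q = begin
  p                      ≡⟨ sym pal-p ⟩
  reverse p              ≡⟨ cong reverse p≡h++q ⟩
  reverse (h ++ q)       ≡⟨ reverse-++ h q ⟩
  reverse q ++ reverse h ≡⟨ cong (_++ reverse h) pal-q ⟩
  q ++ reverse h         ∎
  where open ≡-Reasoning

shorter-palindromic-suffix-in-init : ∀ (w : List A) a {k p q} h → h ≢ [] →
  IsPalindrome p → IsPalindrome q → p ≡ h ++ q → k ++ p ≡ w ∷ʳ a → IsFactor q w
shorter-palindromic-suffix-in-init w a {k} {p} {q} h h≢[] pal-p pal-q p≡h++q k++p≡ =
  factor-of-init w a k q (reverse h)
    (subst (λ r → k ++ r ≡ w ∷ʳ a) (palindromic-suffix-is-prefix pal-p pal-q p≡h++q) k++p≡)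
    (reverse-≢-[] h≢[])

NewPalindrome : List A → A → List A → Set
NewPalindrome w a p = IsPalindrome p × IsFactor p (w ∷ʳ a) × ¬ IsFactor p w

new-palindrome-unique : ∀ (w : List A) a {p q} → NewPalindrome w a p → NewPalindrome w a q → p ≡ q
new-palindrome-unique w a {p} {q} (pal-p , fac-p , p∉w) (pal-q , fac-q , q∉w)
  with new-factor-is-suffix w a p fac-p p∉w | new-factor-is-suffix w a q fac-q q∉w
... | k , k++p≡ | l , l++q≡ with suffixes-comparable k p l q (trans k++p≡ (sym l++q≡))
... | inj₁ ([] , p≡q) = p≡q
... | inj₂ ([] , q≡p) = sym q≡p
... | inj₁ (b ∷ h , p≡) = ⊥-elim (q∉w (shorter-palindromic-suffix-in-init w a (b ∷ h) (λ ()) pal-p pal-q p≡ k++p≡))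
... | inj₂ (b ∷ h , q≡) = ⊥-elim (p∉w (shorter-palindromic-suffix-in-init w a (b ∷ h) (λ ()) pal-q pal-p q≡ l++q≡))

palFactors-of-[] : ∀ {ps : List (List A)} → Unique ps → All (PalFactor []) ps → length ps ≤ 1
palFactors-of-[] {ps = []}          _                 _ = z≤n
palFactors-of-[] {ps = _ ∷ []}      _                 _ = s≤s z≤n
palFactors-of-[] {ps = f ∷ g ∷ _} ((f≢g ∷ _) ∷ _) (pf ∷ pg ∷ _) = ⊥-elim (f≢g (trans (only-[] pf) (sym (only-[] pg))))
  where
  only-[] : ∀ {f : List A} → PalFactor [] f → f ≡ []
  only-[] {f = []}    _                  = refl
  only-[] {f = _ ∷ _} (_ , [] , _ , ())
  only-[] {f = _ ∷ _} (_ , _ ∷ _ , _ , ())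

restrict-palFactors : ∀ {w : List A} {a ps} → All (PalFactor (w ∷ʳ a)) ps →
  All (λ f → IsFactor f w) ps → All (PalFactor w) ps
restrict-palFactors pals olds = All.zipWith (λ ((pal , _) , old) → pal , old) (pals , olds)

palFactor-reverse : ∀ {w f : List A} → PalFactor w f → PalFactor (reverse w) f
palFactor-reverse {f = f} (pal , x , y , refl) = pal , reverse y , reverse x , sym (begin
  reverse (x ++ f ++ y)                ≡⟨ reverse-++ x (f ++ y) ⟩
  reverse (f ++ y) ++ reverse x        ≡⟨ cong (_++ reverse x) (reverse-++ f y) ⟩
  (reverse y ++ reverse f) ++ reverse x ≡⟨ cong (λ g → (reverse y ++ g) ++ reverse x) pal ⟩
  (reverse y ++ f) ++ reverse x        ≡⟨ ++-assoc (reverse y) f (reverse x) ⟩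
  reverse y ++ f ++ reverse x          ∎)
  where open ≡-Reasoning

rich-reverse : ∀ {w : List A} → Rich w → Rich (reverse w)
rich-reverse {w = w} (ps , (uniq , pals , complete) , len) =
  ps , (uniq , All.map palFactor-reverse pals , complete′) , trans len (cong suc (sym (length-reverse w)))
  where
  complete′ : ∀ f → PalFactor (reverse w) f → f ∈ ps
  complete′ f pf = complete f (subst (λ v → PalFactor v f) (reverse-involutive w) (palFactor-reverse pf))

RichAlong : List A → List A → Set
RichAlong w r = ∀ v v′ → v ++ v′ ≡ r → Rich (w ++ v)

rich-along-++ : ∀ (w r s : List A) → RichAlong w r → RichAlong (w ++ r) s → RichAlong w (r ++ s)
rich-along-++ w r s rich-r rich-s v v′ e with ++-≡-++-cases v v′ r s e
... | inj₁ (m , refl , m++v′≡s) = subst Rich (++-assoc w r m) (rich-s m v′ m++v′≡s)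
... | inj₂ (m , r≡v++m , _)     = rich-r v m (sym r≡v++m)

rich-along-∷ : ∀ {w : List A} {a r} → Rich w → RichAlong (w ∷ʳ a) r → RichAlong w (a ∷ r)
rich-along-∷ {w = w} rich _     []      _  _ = subst Rich (sym (++-identityʳ w)) rich
rich-along-∷ {w = w} {a} _ along (_ ∷ v) v′ e with ∷-injective e
... | refl , e′ = subst Rich (++-assoc w [ a ] v) (along v v′ e′)

ProperPalSuffix : List A → List A → Set
ProperPalSuffix w q = IsPalindrome q × ∃ λ k → k ≢ [] × k ++ q ≡ w

LongestProperPalSuffix : List A → List A → Set
LongestProperPalSuffix w q = ProperPalSuffix w q × (∀ q′ → ProperPalSuffix w q′ → length q′ ≤ length q)

RichBranching : List A → List A → Set
RichBranching w u = Rich (w ++ u) × ∃ λ a → ∃ λ b → ¬ (a ≡ b) × a ∈ (w ++ u) × b ∈ (w ++ u)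
  × Rich (w ++ u ++ [ a ]) × Rich (w ++ u ++ [ b ])

-- An occurrence of c^R in the |π|-periodic word π w rs can be moved by ±|π|: forward until it ends
-- after w, then backward until it ends less than |π| after w. A backward move is impossible only
-- when the run covers all of w.
module PeriodicShift {A : Set} (w rs π π′ : List A) (c : A) (R : ℕ)
    (π≢[] : π ≢ []) (period : π ++ w ++ rs ≡ (w ++ rs) ++ π′) where

  open import Algebra.Solver.Monoid (++-monoid A) using (solve; _⊜_; _⊕_)

  run : List A
  run = replicate R c

  Occurrence : List A → List A → Set
  Occurrence a b = a ++ run ++ b ≡ π ++ w ++ rs

  π-nonempty : 1 ≤ length π
  π-nonempty = ≢[]⇒length-pos π≢[]

  shift-forward : ∀ fuel a b → Occurrence a b → length w ≤ fuel + (length a + R) →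
    ∃₂ λ a b → Occurrence a b × length w ≤ length a + R
  shift-forward fuel a b e h with length w ≤? length a + R
  ... | yes w≤end = a , b , e , w≤end
  shift-forward zero       a b e h | no w≰end = ⊥-elim (w≰end h)
  shift-forward (suc fuel) a b e h | no w≰end
    with ++-≡-++-cases (a ++ run) b (w ++ rs) π′ (trans (++-assoc a run b) (trans e period))
  ... | inj₁ (m , a++run≡p++m , _) = ⊥-elim (w≰end (begin
    length w                  ≤⟨ length-++-≤ˡ w ⟩
    length (w ++ rs)          ≤⟨ length-++-≤ˡ (w ++ rs) ⟩
    length ((w ++ rs) ++ m)   ≡⟨ cong length (sym a++run≡p++m) ⟩
    length (a ++ run)         ≡⟨ length-++-replicate a R c ⟩
    length a + R              ∎))
    where open ≤-Reasoning
  ... | inj₂ (m , p≡a++run++m , _) = shift-forward fuel (π ++ a) m shifted (begin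
    length w                           ≤⟨ h ⟩
    suc fuel + (length a + R)          ≡⟨ sym (+-suc fuel _) ⟩
    fuel + suc (length a + R)          ≤⟨ +-monoʳ-≤ fuel (+-monoˡ-≤ (length a + R) π-nonempty) ⟩
    fuel + (length π + (length a + R)) ≡⟨ cong (fuel +_) (sym (+-assoc (length π) (length a) R)) ⟩
    fuel + ((length π + length a) + R) ≡⟨ cong (λ n → fuel + (n + R)) (sym (length-++ π)) ⟩
    fuel + (length (π ++ a) + R)       ∎)
    where
    open ≤-Reasoning
    shifted : Occurrence (π ++ a) m
    shifted = trans (solve 4 (λ P A U M → (P ⊕ A) ⊕ U ⊕ M ⊜ P ⊕ ((A ⊕ U) ⊕ M)) refl π a run m)
      (cong (π ++_) (sym p≡a++run++m))

  shift-backward : ¬ All (_≡ c) w → ∀ fuel a b → Occurrence a b → length w ≤ length a + R → length a + R ≤ fuel →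
    ∃₂ λ a b → Occurrence a b × length w ≤ length a + R × length a + R < length w + length π
  shift-backward not-run fuel a b e w≤end end≤fuel with length a + R <? length w + length π
  ... | yes end< = a , b , e , w≤end , end<
  ... | no end≮ with ++-≡-++-cases a (run ++ b) π (w ++ rs) e
  ...   | inj₂ (m , π≡a++m , run++b≡m++p) = ⊥-elim (not-run (run-prefix-all R c {m} run++b≡m++p inside-run))
    where
    inside-run : length m + length w ≤ R
    inside-run = +-cancelˡ-≤ (length a) _ _ (begin
      length a + (length m + length w) ≡⟨ trans (sym (+-assoc (length a) _ _)) (+-comm _ (length w)) ⟩
      length w + (length a + length m) ≡⟨ cong (length w +_) (sym (trans (cong length π≡a++m) (length-++ a))) ⟩
      length w + length π              ≤⟨ ≮⇒≥ end≮ ⟩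
      length a + R                     ∎)
      where open ≤-Reasoning
  shift-backward not-run zero       a b e w≤end end≤0 | no end≮ | inj₁ _ =
    ⊥-elim (1+n≰n (≤-trans (≤-trans π-nonempty (m≤n+m (length π) (length w))) (≤-trans (≮⇒≥ end≮) end≤0)))
  shift-backward not-run (suc fuel) a b e w≤end end≤fuel | no end≮ | inj₁ (m , a≡π++m , m++run++b≡p) =
    shift-backward not-run fuel m (b ++ π′) shifted
      (+-cancelˡ-≤ (length π) _ _ (begin
        length π + length w       ≡⟨ +-comm (length π) (length w) ⟩
        length w + length π       ≤⟨ ≮⇒≥ end≮ ⟩
        length a + R              ≡⟨ end≡ ⟩
        length π + (length m + R) ∎))
      (≤-pred (begin
        suc (length m + R)        ≤⟨ +-monoˡ-≤ (length m + R) π-nonempty ⟩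
        length π + (length m + R) ≡⟨ sym end≡ ⟩
        length a + R              ≤⟨ end≤fuel ⟩
        suc fuel                  ∎))
    where
    open ≤-Reasoning
    end≡ : length a + R ≡ length π + (length m + R)
    end≡ = trans (cong (λ v → length v + R) a≡π++m) (trans (cong (_+ R) (length-++ π)) (+-assoc (length π) _ R))
    shifted : Occurrence m (b ++ π′)
    shifted = trans (solve 4 (λ M U B P′ → M ⊕ U ⊕ B ⊕ P′ ⊜ (M ⊕ U ⊕ B) ⊕ P′) refl m run b π′)
      (trans (cong (_++ π′) m++run++b≡p) (sym period))

run-near-period-boundary : ∀ (w rs π π′ : List A) c R → π ≢ [] → ¬ All (_≡ c) w →
  π ++ w ++ rs ≡ (w ++ rs) ++ π′ → IsFactor (replicate R c) (π ++ w ++ rs) →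
  ∃₂ λ a b → a ++ replicate R c ++ b ≡ π ++ w ++ rs × length w ≤ length a + R × length a + R < length w + length π
run-near-period-boundary w rs π π′ c R π≢[] not-run period (a , b , e) =
  let (a′ , b′ , e′ , w≤end) = shift-forward (length w) a b e (m≤m+n (length w) _)
  in  shift-backward not-run (length a′ + R) a′ b′ e′ w≤end ≤-refl
  where open PeriodicShift w rs π π′ c R π≢[] period

module _ {A : Set} (_≟_ : DecidableEquality A) where

  open import Algebra.Solver.Monoid (++-monoid A) using (solve; _⊜_; _⊕_)

  prefix? : (f w : List A) → Dec (∃ λ y → f ++ y ≡ w)
  prefix? []      w       = yes (w , refl)
  prefix? (a ∷ f) []      = no λ ()
  prefix? (a ∷ f) (b ∷ w) with a ≟ b | prefix? f w
  ... | no a≢b   | _           = no λ (y , e) → a≢b (proj₁ (∷-injective e))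
  ... | yes refl | yes (y , e) = yes (y , cong (a ∷_) e)
  ... | yes refl | no ¬pre     = no λ (y , e) → ¬pre (y , ∷-injectiveʳ e)

  factor? : (f w : List A) → Dec (IsFactor f w)
  factor? f w with prefix? f w
  ... | yes (y , e) = yes ([] , y , e)
  factor? f []      | no ¬pre = no λ { ([] , y , e) → ¬pre (y , e) ; (_ ∷ _ , _ , ()) }
  factor? f (a ∷ w) | no ¬pre with factor? f w
  ... | yes (x , y , e) = yes (a ∷ x , y , cong (a ∷_) e)
  ... | no ¬fac = no λ { ([] , y , e) → ¬pre (y , e) ; (_ ∷ x , y , e) → ¬fac (x , y , ∷-injectiveʳ e) }

  occursIn? : (w : List A) → Decidable (λ f → IsFactor f w)
  occursIn? w f = factor? f w

  at-most-one-new-palFactor : ∀ w a {ps} → Unique ps → All (PalFactor (w ∷ʳ a)) ps →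
    length ps ≤ suc (length (filter (occursIn? w) ps))
  at-most-one-new-palFactor w a {[]}     _                    _                       = z≤n
  at-most-one-new-palFactor w a {f ∷ ps} (f∉ps ∷ uniq) ((pal , fac) ∷ pals) = step (occursIn? w f)
    where
    rest-old : ¬ IsFactor f w → ∀ {g} → g ∈ ps → IsFactor g w
    rest-old new {g} g∈ps with occursIn? w g | All.lookup pals g∈ps
    ... | yes old  | _             = old
    ... | no new-g | pal-g , fac-g = ⊥-elim (All.lookup f∉ps g∈ps
      (new-palindrome-unique w a (pal , fac , new) (pal-g , fac-g , new-g)))
    step : Dec (IsFactor f w) → suc (length ps) ≤ suc (length (filter (occursIn? w) (f ∷ ps)))
    step (yes old) = ≤-trans (s≤s (at-most-one-new-palFactor w a uniq pals))
      (≤-reflexive (cong (suc ∘ length) (sym (filter-accept (occursIn? w) old))))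
    step (no new) = ≤-reflexive (cong (suc ∘ length) (sym
      (trans (filter-reject (occursIn? w) new) (filter-all (occursIn? w) (All.tabulate (rest-old new))))))

  filter-palFactors : ∀ w a {ps} → All (PalFactor (w ∷ʳ a)) ps → All (PalFactor w) (filter (occursIn? w) ps)
  filter-palFactors w a {ps} pals =
    restrict-palFactors (All.filter⁺ (occursIn? w) pals) (All.all-filter (occursIn? w) ps)

  palFactors-bound : ∀ w {ps} → Unique ps → All (PalFactor w) ps → length ps ≤ suc (length w)
  palFactors-bound w = go (reverseView w)
    where
    go : ∀ {w} → Reverse w → ∀ {ps} → Unique ps → All (PalFactor w) ps → length ps ≤ suc (length w)
    go []              uniq pals = palFactors-of-[] uniq pals
    go (w ∶ rw ∶ʳ a) {ps} uniq pals = begin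
      length ps                                ≤⟨ at-most-one-new-palFactor w a uniq pals ⟩
      suc (length (filter (occursIn? w) ps))   ≤⟨ s≤s (go rw (Unique.filter⁺ (occursIn? w) uniq) (filter-palFactors w a pals)) ⟩
      suc (suc (length w))                     ≡⟨ cong suc (sym (length-∷ʳ w a)) ⟩
      suc (length (w ∷ʳ a))                    ∎
      where open ≤-Reasoning

  rich-∷ʳ-new-palindrome : ∀ w a → Rich (w ∷ʳ a) → ∃ (NewPalindrome w a)
  rich-∷ʳ-new-palindrome w a (ps , (uniq , pals , _) , len) with all? (occursIn? w) ps
  ... | yes olds = ⊥-elim (1+n≰n (begin
    suc (suc (length w))  ≡⟨ cong suc (sym (length-∷ʳ w a)) ⟩
    suc (length (w ∷ʳ a)) ≡⟨ sym len ⟩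
    length ps             ≤⟨ palFactors-bound w uniq (restrict-palFactors pals olds) ⟩
    suc (length w)        ∎))
    where open ≤-Reasoning
  ... | no ¬olds with All.lookupAny pals (All.¬All⇒Any¬ (occursIn? w) ps ¬olds)
  ...   | (pal , fac) , new = _ , pal , fac , new

  rich-init : ∀ w a → Rich (w ∷ʳ a) → Rich w
  rich-init w a (ps , (uniq , pals , complete) , len) =
    qs , (uniq′ , pals′ , complete′) , ≤-antisym (palFactors-bound w uniq′ pals′) (≤-pred (begin
      suc (suc (length w))  ≡⟨ cong suc (sym (length-∷ʳ w a)) ⟩
      suc (length (w ∷ʳ a)) ≡⟨ sym len ⟩
      length ps             ≤⟨ at-most-one-new-palFactor w a uniq pals ⟩
      suc (length qs)       ∎))
    where
    open ≤-Reasoning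
    qs : List (List A)
    qs = filter (occursIn? w) ps
    uniq′ : Unique qs
    uniq′ = Unique.filter⁺ (occursIn? w) uniq
    pals′ : All (PalFactor w) qs
    pals′ = filter-palFactors w a pals
    complete′ : ∀ f → PalFactor w f → f ∈ qs
    complete′ f (pal , fac) = ∈-filter⁺ (occursIn? w) (complete f (pal , factor-++ʳ [ a ] fac)) fac

  rich-∷ʳ : ∀ w a {p} → Rich w → NewPalindrome w a p → Rich (w ∷ʳ a)
  rich-∷ʳ w a {p} (ps , (uniq , pals , complete) , len) new@(pal , fac , p∉w) =
    p ∷ ps , (p∉ps ∷ uniq , (pal , fac) ∷ All.map (λ (pal , fac) → pal , factor-++ʳ [ a ] fac) pals , complete′) ,
    trans (cong suc len) (cong suc (sym (length-∷ʳ w a)))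
    where
    p∉ps : All (p ≢_) ps
    p∉ps = All.tabulate λ f∈ps p≡f → p∉w (subst (λ g → IsFactor g w) (sym p≡f) (proj₂ (All.lookup pals f∈ps)))
    complete′ : ∀ f → PalFactor (w ∷ʳ a) f → f ∈ p ∷ ps
    complete′ f (pal-f , fac-f) with occursIn? w f
    ... | yes old  = there (complete f (pal-f , old))
    ... | no new-f = here (new-palindrome-unique w a (pal-f , fac-f , new-f) new)

  rich-prefix : ∀ w t → Rich (w ++ t) → Rich w
  rich-prefix w t = go (reverseView t)
    where
    go : ∀ {t} → Reverse t → Rich (w ++ t) → Rich w
    go []             rich = subst Rich (++-identityʳ w) rich
    go (t ∶ rt ∶ʳ a) rich = go rt (rich-init (w ++ t) a (subst Rich (sym (++-assoc w t [ a ])) rich))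

  rich-palindrome-suffix : ∀ k r → IsPalindrome (k ++ r) → Rich (k ++ r) → Rich r
  rich-palindrome-suffix k r pal rich = subst Rich (reverse-involutive r)
    (rich-reverse (rich-prefix (reverse r) (reverse k) (subst Rich (trans (sym pal) (reverse-++ k r)) rich)))

  -- Appending the next letter x of r turns the new palindromic suffix p into x p x, which is again
  -- new because p occurs only once.
  rich-along-reflection : ∀ r p w (a : A) → IsPalindrome p → reverse r ++ p ≡ w ∷ʳ a → ¬ IsFactor p w →
    Rich (w ∷ʳ a) → RichAlong (reverse r ++ p) r
  rich-along-reflection r p w a _ e _ rich [] _ _ = subst Rich (sym (trans (++-identityʳ _) e)) rich
  rich-along-reflection (x ∷ r) p w a pal e p∉w rich (_ ∷ v) v′ e-v with ∷-injective e-v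
  ... | refl , e-v′ = subst Rich (trans (cong (_++ v) reflected) (++-assoc W [ x ] v))
    (rich-along-reflection r (x ∷ p ++ [ x ]) W x (palindrome-wrap x pal) reflected wrapped∉W rich-Wx v v′ e-v′)
    where
    W : List A
    W = reverse (x ∷ r) ++ p
    reflected : reverse r ++ x ∷ p ++ [ x ] ≡ W ∷ʳ x
    reflected = trans (solve 3 (λ R X P → R ⊕ (X ⊕ P ⊕ X) ⊜ ((R ⊕ X) ⊕ P) ⊕ X) refl (reverse r) [ x ] p)
      (cong (λ u → (u ++ p) ∷ʳ x) (sym (unfold-reverse x r)))
    wrapped∉W : ¬ IsFactor (x ∷ p ++ [ x ]) W
    wrapped∉W (c , d , e-W) = p∉w (factor-of-init w a (c ∷ʳ x) p (x ∷ d)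
      (trans (solve 4 (λ C X P D → (C ⊕ X) ⊕ (P ⊕ (X ⊕ D)) ⊜ C ⊕ ((X ⊕ P ⊕ X) ⊕ D)) refl c [ x ] p d) (trans e-W e)) λ ())
    rich-Wx : Rich (W ∷ʳ x)
    rich-Wx = rich-∷ʳ W x (subst Rich (sym e) rich) (palindrome-wrap x pal , suffix⇒factor reflected , wrapped∉W)

  longest-proper-palSuffix : ∀ (w : List A) → w ≢ [] → ∃ (LongestProperPalSuffix w)
  longest-proper-palSuffix []      w≢[] = ⊥-elim (w≢[] refl)
  longest-proper-palSuffix (x ∷ w) _ with ≡-dec _≟_ (reverse w) w
  ... | yes pal-w = w , (pal-w , [ x ] , (λ ()) , refl) , λ _ (_ , _ , k≢[] , e) → proper-suffix-shorter k≢[] e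
  ... | no ¬pal-w with w
  ...   | [] = ⊥-elim (¬pal-w refl)
  ...   | y ∷ w′ with longest-proper-palSuffix (y ∷ w′) (λ ())
  ...     | q , (pal-q , k , _ , e) , longest = q , (pal-q , x ∷ k , (λ ()) , cong (x ∷_) e) , longest′
    where
    longest′ : ∀ q′ → ProperPalSuffix (x ∷ y ∷ w′) q′ → length q′ ≤ length q
    longest′ q′ (_     , []        , k≢[] , _) = ⊥-elim (k≢[] refl)
    longest′ q′ (pal′  , _ ∷ []    , _    , e′) = ⊥-elim (¬pal-w (subst IsPalindrome (∷-injectiveʳ e′) pal′))
    longest′ q′ (pal′  , _ ∷ z ∷ k′ , _   , e′) = longest q′ (pal′ , z ∷ k′ , (λ ()) , ∷-injectiveʳ e′)

  -- The new palindromic suffix of r is neither q, which occurs earlier as a prefix of r, nor a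
  -- suffix of q, which would occur earlier as a prefix of q; so it is longer than q.
  rich-longer-palSuffix : ∀ {r q t : List A} → Rich r → IsPalindrome q → (∃ λ k → k ++ q ≡ r) →
    t ≢ [] → q ++ t ≡ r → ∃ λ n → IsPalindrome n × (∃ λ k → k ++ n ≡ r) × length q < length n
  rich-longer-palSuffix {r} {q} {t} rich pal-q (k , k++q≡r) t≢[] q++t≡r with ∷ʳ-view r
  ... | inj₁ refl = ⊥-elim (t≢[] (++-conicalʳ q t q++t≡r))
  ... | inj₂ (u , a , refl) with rich-∷ʳ-new-palindrome u a rich
  ... | n , pal-n , fac-n , n∉u with new-factor-is-suffix u a n fac-n n∉u
  ... | l , l++n≡ with suffixes-comparable l n k q (trans l++n≡ (sym k++q≡r))
  ... | inj₁ ([] , refl)    = ⊥-elim (n∉u (factor-of-init u a [] q t q++t≡r t≢[]))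
  ... | inj₁ (_ ∷ h , refl) = n , pal-n , (l , l++n≡) , s≤s (length-++-≤ʳ q {h})
  ... | inj₂ (h , q≡h++n)   = ⊥-elim (n∉u (factor-of-init u a [] n (reverse h ++ t) n-prefix
                                 λ e → t≢[] (++-conicalʳ (reverse h) t e)))
    where
    n-prefix : n ++ reverse h ++ t ≡ u ∷ʳ a
    n-prefix = trans (sym (++-assoc n (reverse h) t))
      (trans (cong (_++ t) (sym (palindromic-suffix-is-prefix pal-q pal-n q≡h++n))) q++t≡r)

  -- An occurrence of y q y in p would make the suffix of p starting with that q a rich word with
  -- a palindromic suffix longer than q, hence a proper palindromic suffix of p longer than q.
  longest-proper-palSuffix-wrap-new : ∀ {p z q : List A} {y} → Rich p → IsPalindrome p →
    (z ∷ʳ y) ++ q ≡ p → IsPalindrome q → LongestProperPalSuffix p q → ¬ IsFactor (y ∷ q ++ [ y ]) p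
  longest-proper-palSuffix-wrap-new {p} {z} {q} {y} rich pal-p zyq≡p pal-q (_ , longest) (c , d , e) =
    refute (rich-longer-palSuffix rich-r pal-q q-suffix (λ ()) refl)
    where
    r : List A
    r = q ++ y ∷ d
    r-suffix : (c ∷ʳ y) ++ r ≡ p
    r-suffix = trans (solve 4 (λ C Y Q D → (C ⊕ Y) ⊕ (Q ⊕ (Y ⊕ D)) ⊜ C ⊕ ((Y ⊕ Q ⊕ Y) ⊕ D)) refl c [ y ] q d) e
    rich-r : Rich r
    rich-r = rich-palindrome-suffix (c ∷ʳ y) r (subst IsPalindrome (sym r-suffix) pal-p) (subst Rich (sym r-suffix) rich)
    q-suffix : ∃ λ h → h ++ q ≡ r
    q-suffix with suffixes-comparable (c ∷ʳ y) r (z ∷ʳ y) q (trans r-suffix (sym zyq≡p))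
    ... | inj₁ (h , r≡h++q) = h , sym r≡h++q
    ... | inj₂ (h , q≡h++r) = ⊥-elim (<-irrefl refl
          (subst (λ v → length q < length v) (sym q≡h++r) (length-<-infix h q (y ∷ d) (λ ()))))
    refute : ¬ ∃ λ n → IsPalindrome n × (∃ λ k → k ++ n ≡ r) × length q < length n
    refute (n , pal-n , (k , k++n≡r) , q<n) =
      <⇒≱ q<n (longest n (pal-n , (c ∷ʳ y) ++ k , prefix≢[] , trans (++-assoc (c ∷ʳ y) k n) (trans (cong ((c ∷ʳ y) ++_) k++n≡r) r-suffix)))
      where
      prefix≢[] : (c ∷ʳ y) ++ k ≢ []
      prefix≢[] e′ = ++-≢-[] c y k (trans (sym (++-assoc c [ y ] k)) e′)

  rich-palindromic-closure : ∀ (w : List A) → Rich w → w ≢ [] →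
    ∃₂ λ s p → s ++ p ≡ w × p ≢ [] × IsPalindrome p × RichAlong w (reverse s)
  rich-palindromic-closure w rich w≢[] with ∷ʳ-view w
  ... | inj₁ w≡[] = ⊥-elim (w≢[] w≡[])
  ... | inj₂ (u , a , refl) with rich-∷ʳ-new-palindrome u a rich
  ... | p , pal , fac , p∉u with new-factor-is-suffix u a p fac p∉u
  ... | s , s++p≡ = s , p , s++p≡ , p≢[] , pal ,
    subst (λ v → RichAlong v (reverse s)) reflected (rich-along-reflection (reverse s) p u a pal reflected p∉u rich)
    where
    reflected : reverse (reverse s) ++ p ≡ u ∷ʳ a
    reflected = trans (cong (_++ p) (reverse-involutive s)) s++p≡
    p≢[] : p ≢ []
    p≢[] refl = p∉u ([] , u , refl)

  rich-palindrome-periodic-extension : ∀ (p : List A) → Rich p → IsPalindrome p → p ≢ [] →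
    ∃₂ λ z y → (z ∷ʳ y) ++ p ≡ p ++ y ∷ reverse z × suc (length z) ≤ length p × RichAlong p (y ∷ reverse z)
  rich-palindrome-periodic-extension p rich pal-p p≢[] with longest-proper-palSuffix p p≢[]
  ... | q , (pal-q , k , k≢[] , k++q≡p) , longest with ∷ʳ-view k
  ... | inj₁ k≡[] = ⊥-elim (k≢[] k≡[])
  ... | inj₂ (z , y , refl) = z , y , period , length-z , rich-along-∷ rich
    (subst (λ v → RichAlong v (reverse z)) reflected (rich-along-reflection (reverse z) T p y (palindrome-wrap y pal-q) reflected wrapped∉p rich-py))
    where
    T : List A
    T = y ∷ q ++ [ y ]
    wrapped∉p : ¬ IsFactor T p
    wrapped∉p = longest-proper-palSuffix-wrap-new rich pal-p k++q≡p pal-q ((pal-q , z ∷ʳ y , k≢[] , k++q≡p) , longest)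
    reflected : reverse (reverse z) ++ T ≡ p ∷ʳ y
    reflected = trans (cong (_++ T) (reverse-involutive z))
      (trans (solve 3 (λ Z Y Q → Z ⊕ (Y ⊕ Q ⊕ Y) ⊜ ((Z ⊕ Y) ⊕ Q) ⊕ Y) refl z [ y ] q) (cong (_∷ʳ y) k++q≡p))
    rich-py : Rich (p ∷ʳ y)
    rich-py = rich-∷ʳ p y rich (palindrome-wrap y pal-q , suffix⇒factor reflected , wrapped∉p)
    period : (z ∷ʳ y) ++ p ≡ p ++ y ∷ reverse z
    period = begin
      (z ∷ʳ y) ++ p                      ≡⟨ cong ((z ∷ʳ y) ++_) (palindromic-suffix-is-prefix pal-p pal-q (sym k++q≡p)) ⟩
      (z ∷ʳ y) ++ q ++ reverse (z ∷ʳ y)  ≡⟨ sym (++-assoc (z ∷ʳ y) q _) ⟩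
      ((z ∷ʳ y) ++ q) ++ reverse (z ∷ʳ y) ≡⟨ cong₂ _++_ k++q≡p (reverse-++ z [ y ]) ⟩
      p ++ y ∷ reverse z                 ∎
      where open ≡-Reasoning
    length-z : suc (length z) ≤ length p
    length-z = subst₂ _≤_ (length-∷ʳ z y) (cong length k++q≡p) (length-++-≤ˡ (z ∷ʳ y))

  longest-run : ∀ (c : A) w → ∃ λ R → IsFactor (replicate R c) w × ¬ IsFactor (replicate (suc R) c) w
  longest-run c w = go 0 (suc (length w)) ≤-refl ([] , w , refl)
    where
    go : ∀ n fuel → length w < n + fuel → IsFactor (replicate n c) w →
      ∃ λ R → IsFactor (replicate R c) w × ¬ IsFactor (replicate (suc R) c) w
    go n fuel bound occ with factor? (replicate (suc n) c) w
    ... | no ¬occ = n , occ , ¬occ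
    go n zero        bound _ | yes occ′ = ⊥-elim (<⇒≱ (subst (length w <_) (+-identityʳ n) bound)
      (≤-trans (n≤1+n n) (subst (_≤ length w) (length-replicate (suc n)) (factor-length-≤ occ′))))
    go n (suc fuel) bound _ | yes occ′ = go (suc n) fuel (subst (length w <_) (+-suc n fuel) bound) occ′

  rich-extensions-after-longest-run : ∀ {W V : List A} {g c} R → Rich W → (V ∷ʳ g) ++ replicate R c ≡ W →
    ¬ IsFactor (replicate (suc R) c) W →
    g ≢ c × Rich (W ∷ʳ c) × Rich (W ∷ʳ c ∷ʳ c) × Rich (W ∷ʳ c ∷ʳ g)
  rich-extensions-after-longest-run {W} {V} {g} {c} R rich e longest = g≢c , rich-Wc , rich-Wcc , rich-Wcg
    where
    run-∷ʳ : ∀ {a W n} → a ++ replicate n c ≡ W → a ++ replicate (suc n) c ≡ W ∷ʳ c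
    run-∷ʳ {a} {n = n} refl = trans (cong (a ++_) (sym (replicate-∷ʳ n c))) (sym (++-assoc a (replicate n c) [ c ]))
    g≢c : g ≢ c
    g≢c refl = longest (suffix⇒factor (trans (sym (++-assoc V [ g ] (replicate R c))) e))
    longer-absent : ¬ IsFactor (replicate (suc (suc R)) c) (W ∷ʳ c)
    longer-absent (x , y , e′) = longest (factor-of-init W c x (replicate (suc R) c) (c ∷ y)
      (trans (cong (x ++_) (trans (sym (++-assoc (replicate (suc R) c) [ c ] y)) (cong (_++ y) (replicate-∷ʳ (suc R) c)))) e′)
      λ ())
    rich-Wc : Rich (W ∷ʳ c)
    rich-Wc = rich-∷ʳ W c rich (palindrome-replicate (suc R) c , suffix⇒factor {k = V ∷ʳ g} (run-∷ʳ e) , longest)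
    rich-Wcc : Rich (W ∷ʳ c ∷ʳ c)
    rich-Wcc = rich-∷ʳ (W ∷ʳ c) c rich-Wc
      (palindrome-replicate (suc (suc R)) c , suffix⇒factor {k = V ∷ʳ g} (run-∷ʳ (run-∷ʳ e)) , longer-absent)
    wrapped-run-absent : ¬ IsFactor (g ∷ replicate (suc R) c ++ [ g ]) (W ∷ʳ c)
    wrapped-run-absent (x , y , e′) = longest (factor-of-init W c (x ∷ʳ g) (replicate (suc R) c) (g ∷ y)
      (trans (solve 4 (λ X G C Y → (X ⊕ G) ⊕ (C ⊕ (G ⊕ Y)) ⊜ X ⊕ ((G ⊕ C ⊕ G) ⊕ Y)) refl x [ g ] (replicate (suc R) c) y) e′) λ ())
    wrapped-suffix : V ++ g ∷ replicate (suc R) c ++ [ g ] ≡ W ∷ʳ c ∷ʳ g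
    wrapped-suffix = trans (solve 3 (λ V G C → V ⊕ (G ⊕ C ⊕ G) ⊜ ((V ⊕ G) ⊕ C) ⊕ G) refl V [ g ] (replicate (suc R) c))
      (cong (_∷ʳ g) (run-∷ʳ e))
    rich-Wcg : Rich (W ∷ʳ c ∷ʳ g)
    rich-Wcg = rich-∷ʳ (W ∷ʳ c) g rich-Wc
      (palindrome-wrap g (palindrome-replicate (suc R) c) , suffix⇒factor wrapped-suffix , wrapped-run-absent)

  branching-after-longest-run : ∀ (w u a : List A) c R → Rich (w ++ u) → a ++ replicate R c ≡ w ++ u →
    ¬ IsFactor (replicate (suc R) c) (w ++ u) → ¬ All (_≡ c) w → c ∈ w → RichBranching w (u ∷ʳ c)
  branching-after-longest-run w u a c R rich e longest not-run c∈w with ∷ʳ-view a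
  ... | inj₁ refl = ⊥-elim (not-run (All.++⁻ˡ w (subst (All (_≡ c)) e (All.replicate⁺ R refl))))
  ... | inj₂ (V , g , refl) with rich-extensions-after-longest-run R rich e longest
  ... | g≢c , rich-c , rich-cc , rich-cg =
    subst Rich (++-assoc w u [ c ]) rich-c , c , g , (λ c≡g → g≢c (sym c≡g)) ,
    ∈-++⁺ˡ c∈w , g∈ , subst Rich (reassoc c) rich-cc , subst Rich (reassoc g) rich-cg
    where
    reassoc : ∀ t → (w ++ u) ∷ʳ c ∷ʳ t ≡ w ++ (u ∷ʳ c) ∷ʳ t
    reassoc t = trans (cong (_∷ʳ t) (++-assoc w u [ c ])) (++-assoc w (u ∷ʳ c) [ t ])
    g∈ : g ∈ w ++ u ∷ʳ c
    g∈ = subst (g ∈_) (++-assoc w u [ c ])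
      (∈-++⁺ˡ (subst (g ∈_) e (∈-++⁺ˡ (∈-++⁺ʳ V (here refl)))))

  periodic-branching : ∀ (w rs π π′ : List A) c → π ≢ [] → c ∈ w → ¬ All (_≡ c) w →
    π ++ w ++ rs ≡ (w ++ rs) ++ π′ → RichAlong w (rs ++ π′) → ∃ λ u → length u ≤ length π × RichBranching w u
  periodic-branching w rs π π′ c π≢[] c∈w not-run period along with longest-run c (π ++ w ++ rs)
  ... | R , occ , longest with run-near-period-boundary w rs π π′ c R π≢[] not-run period occ
  ... | a , b , e , w≤end , end<
    with prefix-split (a ++ replicate R c) b w (rs ++ π′)
           (trans (++-assoc a _ b) (trans e (trans period (++-assoc w rs π′))))
           (subst (length w ≤_) (sym (length-++-replicate a R c)) w≤end)
  ... | u , a++run≡w++u , u++b≡rs++π′ =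
    u ∷ʳ c , u∷ʳc≤π , branching-after-longest-run w u a c R (along u b u++b≡rs++π′) a++run≡w++u longest′ not-run c∈w
    where
    longest′ : ¬ IsFactor (replicate (suc R) c) (w ++ u)
    longest′ occ′ = longest (subst (IsFactor _) (trans (cong (_++ b) (sym a++run≡w++u)) (trans (++-assoc a _ b) e))
      (factor-++ʳ b occ′))
    u∷ʳc≤π : length (u ∷ʳ c) ≤ length π
    u∷ʳc≤π = subst (_≤ length π) (sym (length-∷ʳ u c)) (+-cancelˡ-< (length w) (length u) (length π) (begin-strict
      length w + length u     ≡⟨ sym (length-++ w) ⟩
      length (w ++ u)         ≡⟨ cong length (sym a++run≡w++u) ⟩
      length (a ++ replicate R c) ≡⟨ length-++-replicate a R c ⟩
      length a + R            <⟨ end< ⟩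
      length w + length π     ∎))
      where open ≤-Reasoning

  rich-branching : ∀ (w : List A) c → Rich w → c ∈ w → ¬ All (_≡ c) w →
    ∃ λ u → length u < 2 * length w × RichBranching w u
  rich-branching w c rich c∈w not-run = from-closure (rich-palindromic-closure w rich w≢[])
    where
    w≢[] : w ≢ []
    w≢[] w≡[] = ∉[] (subst (c ∈_) w≡[] c∈w)
    from-closure : (∃₂ λ s p → s ++ p ≡ w × p ≢ [] × IsPalindrome p × RichAlong w (reverse s)) →
      ∃ λ u → length u < 2 * length w × RichBranching w u
    from-closure (s , p , s++p≡w , p≢[] , pal-p , along-s) =
      from-extension (rich-palindrome-periodic-extension (w ++ reverse s) rich-ws pal-ws (λ e → w≢[] (++-conicalˡ w _ e)))
      where
      rich-ws : Rich (w ++ reverse s)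
      rich-ws = along-s (reverse s) [] (++-identityʳ (reverse s))
      pal-ws : IsPalindrome (w ++ reverse s)
      pal-ws = subst (λ v → IsPalindrome (v ++ reverse s)) s++p≡w
        (subst IsPalindrome (sym (++-assoc s p (reverse s))) (palindrome-closure s pal-p))
      s<w : length s < length w
      s<w = subst (length s <_) (trans (sym (length-++ s)) (cong length s++p≡w)) (m<m+n (length s) (≢[]⇒length-pos p≢[]))
      from-extension : (∃₂ λ z y → (z ∷ʳ y) ++ w ++ reverse s ≡ (w ++ reverse s) ++ y ∷ reverse z
          × suc (length z) ≤ length (w ++ reverse s) × RichAlong (w ++ reverse s) (y ∷ reverse z)) →
        ∃ λ u → length u < 2 * length w × RichBranching w u
      from-extension (z , y , period , z<ws , along-zy) =
        conclude (periodic-branching w (reverse s) (z ∷ʳ y) (y ∷ reverse z) c (++-≢-[] z y []) c∈w not-run period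
          (rich-along-++ w (reverse s) (y ∷ reverse z) along-s along-zy))
        where
        conclude : (∃ λ u → length u ≤ length (z ∷ʳ y) × RichBranching w u) →
          ∃ λ u → length u < 2 * length w × RichBranching w u
        conclude (u , u≤π , branching) = u , <-double (begin
          length u                      ≤⟨ u≤π ⟩
          length (z ∷ʳ y)               ≡⟨ length-∷ʳ z y ⟩
          suc (length z)                ≤⟨ z<ws ⟩
          length (w ++ reverse s)       ≡⟨ length-++ w ⟩
          length w + length (reverse s) ≡⟨ cong (length w +_) (length-reverse s) ⟩
          length w + length s           ∎) s<w , branching
          where open ≤-Reasoning

mainTheorem1 : {A : Set} → DecidableEquality A → (w : List A) → Rich w
    → (∃ λ a → ∃ λ b → ¬ (a ≡ b) × a ∈ w × b ∈ w)
    → ∃ λ u → length u < 2 * length w × Rich (w ++ u)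
      × (∃ λ a → ∃ λ b → ¬ (a ≡ b) × a ∈ (w ++ u) × b ∈ (w ++ u)
         × Rich (w ++ u ++ [ a ]) × Rich (w ++ u ++ [ b ]))
mainTheorem1 _≟_ w rich (c , d , c≢d , c∈w , d∈w) =
  rich-branching _≟_ w c rich c∈w λ all-c → c≢d (sym (All.lookup all-c d∈w))
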